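{- Let $k$ be a positive integer and let $T$ be an $n$-vertex tournament with $\Delta^+(T)-\delta^+(T)\le \frac{n}{10k}-k^2$. Then $T$ contains a $1$-subdivision of $\vec{K}_k$.
   Context: A tournament is a digraph in which for every two distinct vertices $u,v$ exactly one of the arcs $\vec{uv}$, $\vec{vu}$ is present. $\Delta^+(T)$ and $\delta^+(T)$ are the maximum and minimum out-degree of $T$. $\vec{K}_k$ is the complete digraph on $k$ vertices containing all $k(k-1)$ arcs (both $\vec{uv}$ and $\vec{vu}$ for every pair). A $1$-subdivision of a digraph $D$ is obtained by replacing every arc $\vec{uv}$ of $D$ by a directed path of length $2$ from $u$ to $v$ through a new vertex (distinct new vertices for distinct arcs); $T$ contains it if $T$ has a subgraph isomorphic to it. -}

module Defs where

open import Data.Nat using (ℕ; zero; suc; _⊔_; _⊓_)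
open import Data.Bool using (Bool; true; false; T)
open import Data.Fin using (Fin; zero; suc)
open import Data.List using (List; foldr; map; filter; length; allFin)
open import Data.Product using (Σ; _×_; _,_)
open import Data.Sum using (_⊎_)
open import Relation.Nullary using (¬_)
open import Relation.Binary.PropositionalEquality using (_≡_; _≢_)
open import Data.Bool.Properties using (T?)

-- A digraph on vertex set Fin n, given by a (decidable) arc relation:
-- arc u v ≡ true  means the arc u→v is present.
Digraph : ℕ → Set
Digraph n = Fin n → Fin n → Bool

IsTournament : {n : ℕ} → Digraph n → Set
IsTournament {n} A =
  ((u : Fin n) → A u u ≡ false) ×
  ((u v : Fin n) → u ≢ v →
     (A u v ≡ true × A v u ≡ false) ⊎ (A u v ≡ false × A v u ≡ true))

outdeg : {n : ℕ} → Digraph n → Fin n → ℕ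
outdeg {n} A u = length (filter (λ v → T? (A u v)) (allFin n))

Δ⁺ : {n : ℕ} → Digraph n → ℕ
Δ⁺ {n} A = foldr _⊔_ 0 (map (outdeg A) (allFin n))

δ⁺ : {n : ℕ} → Digraph n → ℕ
δ⁺ {zero} A = 0
δ⁺ {suc m} A = foldr _⊓_ (outdeg A zero) (map (outdeg A) (allFin (suc m)))

ContainsSubdivK : {n : ℕ} → Digraph n → ℕ → Set
ContainsSubdivK {n} A k =
  Σ (Fin k → Fin n) λ f →
  Σ (Fin k → Fin k → Fin n) λ g →
    ((i j : Fin k) → f i ≡ f j → i ≡ j) ×
    ((i j : Fin k) → i ≢ j → A (f i) (g i j) ≡ true × A (g i j) (f j) ≡ true) ×
    ((i j i' j' : Fin k) → i ≢ j → i' ≢ j' → g i j ≡ g i' j' → (i ≡ i' × j ≡ j')) ×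
    ((i j l : Fin k) → i ≢ j → g i j ≢ f l)

-- Write #midpoints u v for the number of 2-paths u → w → v and linkage u v for
-- #midpoints u v + #midpoints v u.  Comparing the out-degrees of u and v shows that
-- #midpoints v u ≤ #midpoints u v + (Δ⁺ − δ⁺) + 1, so a pair with large linkage has
-- many midpoints in both directions.  Within distance t (linkage ≤ t) of a vertex u,
-- the out-neighbours of u form a subtournament in which every in-degree is at most t,
-- hence there are at most 2t + 1 of them; likewise for the in-neighbours.  So every
-- t-neighbourhood has at most 4t + 3 vertices and a greedy choice yields k branch
-- vertices pairwise at distance > t.  Taking t = (Δ⁺ − δ⁺) + 2(k² + k), every ordered
-- pair of branch vertices has k² + k midpoints, enough to choose distinct subdivision
-- vertices greedily while avoiding the k branch vertices.
module Submission where

open import Defs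
open import Data.Nat using (ℕ; zero; suc; _+_; _*_; _∸_; _^_; _≤_; _<_; _⊔_; _⊓_; z≤n; s≤s; _≤?_)
open import Data.Nat.Properties hiding (_≟_)
open import Data.Nat.Tactic.RingSolver using (solve-∀)
open import Algebra.Properties.CommutativeMonoid.Sum +-0-commutativeMonoid
  using (sum; sum-syntax; sum-cong-≗; sum-replicate-zero; ∑-distrib-+; ∑-comm)
open import Algebra.Properties.Semiring.Sum +-*-semiring using (*-distribˡ-sum; *-distribʳ-sum)
open import Data.Bool using (Bool; true; false; _∧_; _∨_)
open import Data.Bool.Properties using (T?; ∨-conicalˡ; ∨-conicalʳ; ∧-conicalˡ; ∧-conicalʳ; ∨-zeroʳ)
open import Data.Fin using (Fin; zero; suc; _≟_; combine; remQuot)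
open import Data.Fin.Properties using (combine-injective; remQuot-combine)
open import Data.List using (foldr; map; filter; length; tabulate)
open import Data.Product using (Σ-syntax; ∃-syntax; _×_; _,_; proj₁; proj₂; uncurry; swap)
open import Data.Sum using (_⊎_; inj₁; inj₂)
import Data.Sum as Sum
open import Function using (_∘_; id; mk⇔)
open import Relation.Nullary using (¬_; Dec; does; yes; no; contradiction)
open import Relation.Nullary.Decidable using (dec-true; dec-false; does-⇔)
open import Relation.Binary.PropositionalEquality

does-true⇒ : ∀ {a} {P : Set a} (p? : Dec P) → does p? ≡ true → P
does-true⇒ (yes p) _ = p

does-false⇒¬ : ∀ {a} {P : Set a} (p? : Dec P) → does p? ≡ false → ¬ P
does-false⇒¬ (no ¬p) _ = ¬p

m*m≤m*n⇒m≤n : ∀ m n → m * m ≤ m * n → m ≤ n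
m*m≤m*n⇒m≤n zero    n _  = z≤n
m*m≤m*n⇒m≤n (suc m) n le = *-cancelˡ-≤ (suc m) le

m+m≤n+n⇒m≤n : ∀ m n → m + m ≤ n + n → m ≤ n
m+m≤n+n⇒m≤n m n le with m ≤? n
... | yes m≤n = m≤n
... | no  m≰n = contradiction le (<⇒≱ (+-mono-< (≰⇒> m≰n) (≰⇒> m≰n)))

sum-mono-≤ : ∀ {n} {f g : Fin n → ℕ} → (∀ i → f i ≤ g i) → sum f ≤ sum g
sum-mono-≤ {zero}  f≤g = z≤n
sum-mono-≤ {suc n} f≤g = +-mono-≤ (f≤g zero) (sum-mono-≤ (f≤g ∘ suc))

∑-distrib-+₃ : ∀ {n} (f g h : Fin n → ℕ) →
  ∑[ i < n ] (f i + g i + h i) ≡ ∑[ i < n ] f i + ∑[ i < n ] g i + ∑[ i < n ] h i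
∑-distrib-+₃ f g h =
  trans (∑-distrib-+ (λ i → f i + g i) h) (cong (_+ sum h) (∑-distrib-+ f g))

𝟙 : Bool → ℕ
𝟙 true  = 1
𝟙 false = 0

count : ∀ {n} → (Fin n → Bool) → ℕ
count {n} p = ∑[ w < n ] 𝟙 (p w)

count-const-true : ∀ {n} → count {n} (λ _ → true) ≡ n
count-const-true {zero}  = refl
count-const-true {suc n} = cong suc (count-const-true {n})

count-const-false : ∀ {n} → count {n} (λ _ → false) ≡ 0
count-const-false {n} = sum-replicate-zero n

count-≟ : ∀ {n} (v : Fin n) → count (λ w → does (v ≟ w)) ≡ 1
count-≟ {suc n} zero    = cong suc (count-const-false {n})
count-≟ {suc n} (suc v) = count-≟ v

count-⊆ : ∀ {n} {p q : Fin n → Bool} → (∀ w → p w ≡ true → q w ≡ true) → count p ≤ count q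
count-⊆ p⊆q = sum-mono-≤ (λ w → 𝟙-mono (p⊆q w))
  where
  𝟙-mono : ∀ {a b} → (a ≡ true → b ≡ true) → 𝟙 a ≤ 𝟙 b
  𝟙-mono {false} _   = z≤n
  𝟙-mono {true}  a⇒b rewrite a⇒b refl = ≤-refl

count-∨ : ∀ {n} (p q : Fin n → Bool) → count (λ w → p w ∨ q w) ≤ count p + count q
count-∨ p q = ≤-trans (sum-mono-≤ (λ w → 𝟙-∨ (p w) (q w))) (≤-reflexive (∑-distrib-+ (𝟙 ∘ p) (𝟙 ∘ q)))
  where
  𝟙-∨ : ∀ a b → 𝟙 (a ∨ b) ≤ 𝟙 a + 𝟙 b
  𝟙-∨ true  b = s≤s z≤n
  𝟙-∨ false b = ≤-refl

count-disjoint-⊆ : ∀ {n} {p q r : Fin n → Bool} → (∀ w → p w ≡ true → q w ≡ false) →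
  (∀ w → p w ≡ true → r w ≡ true) → (∀ w → q w ≡ true → r w ≡ true) →
  count p + count q ≤ count r
count-disjoint-⊆ {p = p} {q} {r} disjoint p⊆r q⊆r =
  ≤-trans (≤-reflexive (sym (∑-distrib-+ (𝟙 ∘ p) (𝟙 ∘ q)))) (sum-mono-≤ pointwise)
  where
  pointwise : ∀ w → 𝟙 (p w) + 𝟙 (q w) ≤ 𝟙 (r w)
  pointwise w with p w in pw | q w in qw
  ... | true  | true  = contradiction (trans (sym qw) (disjoint w pw)) λ ()
  ... | true  | false rewrite p⊆r w pw = ≤-refl
  ... | false | true  rewrite q⊆r w qw = ≤-refl
  ... | false | false = z≤n

witness-or-count≤ : ∀ {n} (p q : Fin n → Bool) →
  (∃[ w ] p w ≡ true × q w ≡ false) ⊎ count p ≤ count q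
witness-or-count≤ {zero}  p q = inj₂ z≤n
witness-or-count≤ {suc n} p q with witness-or-count≤ (p ∘ suc) (q ∘ suc)
... | inj₁ (w , pw , qw) = inj₁ (suc w , pw , qw)
... | inj₂ le with p zero in p₀ | q zero in q₀
...   | true  | false = inj₁ (zero , p₀ , q₀)
...   | true  | true  = inj₂ (s≤s le)
...   | false | true  = inj₂ (m≤n⇒m≤1+n le)
...   | false | false = inj₂ le

pigeonhole : ∀ {n} (p q : Fin n → Bool) → count q < count p → ∃[ w ] p w ≡ true × q w ≡ false
pigeonhole p q lt with witness-or-count≤ p q
... | inj₁ witness = witness
... | inj₂ p≤q     = contradiction lt (≤⇒≯ p≤q)

fresh : ∀ {n} (X : Fin n → Bool) → count X < n → ∃[ w ] X w ≡ false
fresh X lt with pigeonhole (λ _ → true) X (subst (count X <_) (sym count-const-true) lt)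
... | w , _ , w∉X = w , w∉X

image : ∀ {m n} → (Fin m → Fin n) → Fin n → Bool
image {zero}  f w = false
image {suc m} f w = does (f zero ≟ w) ∨ image (f ∘ suc) w

count-image : ∀ {m n} (f : Fin m → Fin n) → count (image f) ≤ m
count-image {zero} {n} f = ≤-reflexive (count-const-false {n})
count-image {suc m} f =
  ≤-trans (count-∨ (λ w → does (f zero ≟ w)) (image (f ∘ suc)))
          (+-mono-≤ (≤-reflexive (count-≟ (f zero))) (count-image (f ∘ suc)))

∉image : ∀ {m n} (f : Fin m → Fin n) {w} → image f w ≡ false → ∀ i → f i ≢ w
∉image f {w} w∉f zero    = does-false⇒¬ (f zero ≟ w) (∨-conicalˡ _ _ w∉f)
∉image f {w} w∉f (suc i) = ∉image (f ∘ suc) (∨-conicalʳ _ _ w∉f) i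

distinct-representatives : ∀ {m n} (C : Fin m → Fin n → Bool) (F : Fin n → Bool) →
  (∀ i → m + count F ≤ count (C i)) →
  Σ[ h ∈ (Fin m → Fin n) ] (∀ i → C i (h i) ≡ true × F (h i) ≡ false) × (∀ i j → h i ≡ h j → i ≡ j)
distinct-representatives {zero}  C F _ = (λ ()) , (λ ()) , (λ ())
distinct-representatives {suc m} {n} C F large
  with pigeonhole (C zero) F (≤-trans (s≤s (m≤n+m (count F) m)) (large zero))
... | w , w∈C₀ , w∉F
  with distinct-representatives (C ∘ suc) (λ v → does (w ≟ v) ∨ F v) large′
  where
  large′ : ∀ i → m + count (λ v → does (w ≟ v) ∨ F v) ≤ count (C (suc i))
  large′ i = begin
    m + count (λ v → does (w ≟ v) ∨ F v)       ≤⟨ +-monoʳ-≤ m (count-∨ _ F) ⟩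
    m + (count (λ v → does (w ≟ v)) + count F) ≡⟨ cong (λ x → m + (x + count F)) (count-≟ w) ⟩
    m + suc (count F)                          ≡⟨ +-suc m (count F) ⟩
    suc m + count F                            ≤⟨ large (suc i) ⟩
    count (C (suc i))                          ∎
    where open ≤-Reasoning
... | h , h-ok , h-inj = h′ , h′-ok , h′-inj
  where
  h′ : Fin (suc m) → Fin n
  h′ zero    = w
  h′ (suc i) = h i

  h≢w : ∀ i → w ≢ h i
  h≢w i = does-false⇒¬ (w ≟ h i) (∨-conicalˡ _ _ (proj₂ (h-ok i)))

  h′-ok : ∀ i → C i (h′ i) ≡ true × F (h′ i) ≡ false
  h′-ok zero    = w∈C₀ , w∉F
  h′-ok (suc i) = proj₁ (h-ok i) , ∨-conicalʳ _ _ (proj₂ (h-ok i))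

  h′-inj : ∀ i j → h′ i ≡ h′ j → i ≡ j
  h′-inj zero    zero    _ = refl
  h′-inj zero    (suc j) e = contradiction e (h≢w j)
  h′-inj (suc i) zero    e = contradiction (sym e) (h≢w i)
  h′-inj (suc i) (suc j) e = cong suc (h-inj i j e)

count-filter-tabulate : ∀ {m n} (p : Fin n → Bool) (f : Fin m → Fin n) →
  length (filter (T? ∘ p) (tabulate f)) ≡ count (p ∘ f)
count-filter-tabulate {zero}  p f = refl
count-filter-tabulate {suc m} p f with p (f zero)
... | true  = cong suc (count-filter-tabulate p (f ∘ suc))
... | false = count-filter-tabulate p (f ∘ suc)

≤-max-tabulate : ∀ {m n} (g : Fin n → ℕ) (f : Fin m → Fin n) i →
  g (f i) ≤ foldr _⊔_ 0 (map g (tabulate f))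
≤-max-tabulate g f zero    = m≤m⊔n _ _
≤-max-tabulate g f (suc i) = ≤-trans (≤-max-tabulate g (f ∘ suc) i) (m≤n⊔m _ _)

min-tabulate-≤ : ∀ {m n} (g : Fin n → ℕ) b (f : Fin m → Fin n) i →
  foldr _⊓_ b (map g (tabulate f)) ≤ g (f i)
min-tabulate-≤ g b f zero    = m⊓n≤m _ _
min-tabulate-≤ g b f (suc i) = ≤-trans (m⊓n≤n _ _) (min-tabulate-≤ g b (f ∘ suc) i)

δ⁺≤outdeg : ∀ {n} (A : Digraph n) u → δ⁺ A ≤ outdeg A u
δ⁺≤outdeg {suc _} A = min-tabulate-≤ (outdeg A) (outdeg A zero) id

outdeg≡count : ∀ {n} (A : Digraph n) u → outdeg A u ≡ count (A u)
outdeg≡count A u = count-filter-tabulate (A u) id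

outdeg≤Δ⁺ : ∀ {n} (A : Digraph n) u → outdeg A u ≤ Δ⁺ A
outdeg≤Δ⁺ A = ≤-max-tabulate (outdeg A) id

outdeg≤outdeg+Δ⁺∸δ⁺ : ∀ {n} (A : Digraph n) u v → outdeg A v ≤ outdeg A u + (Δ⁺ A ∸ δ⁺ A)
outdeg≤outdeg+Δ⁺∸δ⁺ A u v = begin
  outdeg A v                 ≤⟨ outdeg≤Δ⁺ A v ⟩
  Δ⁺ A                       ≤⟨ m≤n+m∸n (Δ⁺ A) (δ⁺ A) ⟩
  δ⁺ A + (Δ⁺ A ∸ δ⁺ A)       ≤⟨ +-monoˡ-≤ _ (δ⁺≤outdeg A u) ⟩
  outdeg A u + (Δ⁺ A ∸ δ⁺ A) ∎
  where open ≤-Reasoning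

∧-intro : ∀ {a b} → a ≡ true → b ≡ true → a ∧ b ≡ true
∧-intro refl refl = refl

arcsInside : ∀ {n} → Digraph n → (Fin n → Bool) → ℕ
arcsInside {n} A S = ∑[ v < n ] count (λ w → S v ∧ (S w ∧ A w v))

arcsInside≤ : ∀ {n} (A : Digraph n) (S : Fin n → Bool) t →
  (∀ v → S v ≡ true → count (λ w → S w ∧ A w v) ≤ t) → arcsInside A S ≤ count S * t
arcsInside≤ {n} A S t indegree≤t =
  ≤-trans (sum-mono-≤ row≤t) (≤-reflexive (sym (*-distribʳ-sum t (𝟙 ∘ S))))
  where
  row≤t : ∀ v → count (λ w → S v ∧ (S w ∧ A w v)) ≤ 𝟙 (S v) * t
  row≤t v with S v in v∈S
  ... | true  = ≤-trans (indegree≤t v v∈S) (≤-reflexive (sym (+-identityʳ t)))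
  ... | false = ≤-reflexive (count-const-false {n})

transpose : ∀ {n} → Digraph n → Digraph n
transpose A u v = A v u

transpose-IsTournament : ∀ {n} {A : Digraph n} → IsTournament A → IsTournament (transpose A)
transpose-IsTournament (irreflexive , exactlyOne) =
  irreflexive , λ u v u≢v → Sum.swap (Sum.map swap swap (exactlyOne u v u≢v))

module _ {n : ℕ} {A : Digraph n} (tournament : IsTournament A) where

  arc-asym : ∀ {u v} → A u v ≡ true → A v u ≡ false
  arc-asym {u} {v} uv with u ≟ v
  ... | yes refl = contradiction (trans (sym uv) (proj₁ tournament u)) λ ()
  ... | no  u≢v with proj₂ tournament u v u≢v
  ...   | inj₁ (_ , vu)  = vu
  ...   | inj₂ (uv′ , _) = contradiction (trans (sym uv) uv′) λ ()

  arc-total : ∀ {u v} → u ≢ v → A u v ≡ false → A v u ≡ true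
  arc-total {u} {v} u≢v ¬uv with proj₂ tournament u v u≢v
  ... | inj₁ (uv , _) = contradiction (trans (sym uv) ¬uv) λ ()
  ... | inj₂ (_ , vu) = vu

  arc-count : ∀ {u v} → u ≢ v → 𝟙 (A u v) + 𝟙 (A v u) ≡ 1
  arc-count {u} {v} u≢v with proj₂ tournament u v u≢v
  ... | inj₁ (uv , vu) rewrite uv | vu = refl
  ... | inj₂ (uv , vu) rewrite uv | vu = refl

  arcsInside-doubled : ∀ S → arcsInside A S + arcsInside A S + count S ≡ count S * count S
  arcsInside-doubled S = begin
    P + P + s
      ≡⟨ cong₂ (λ x y → P + x + y) (∑-comm arcTo) (sym diagonal) ⟩
    P + ∑[ v < n ] ∑[ w < n ] arcTo w v + ∑[ v < n ] ∑[ w < n ] onDiagonal v w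
      ≡⟨ ∑-distrib-+₃ (λ v → ∑[ w < n ] arcTo v w) (λ v → ∑[ w < n ] arcTo w v)
                      (λ v → ∑[ w < n ] onDiagonal v w) ⟨
    ∑[ v < n ] (∑[ w < n ] arcTo v w + ∑[ w < n ] arcTo w v + ∑[ w < n ] onDiagonal v w)
      ≡⟨ sum-cong-≗ (λ v → ∑-distrib-+₃ (arcTo v) (λ w → arcTo w v) (onDiagonal v)) ⟨
    ∑[ v < n ] ∑[ w < n ] (arcTo v w + arcTo w v + onDiagonal v w)
      ≡⟨ sum-cong-≗ (λ v → sum-cong-≗ (pair v)) ⟩
    ∑[ v < n ] ∑[ w < n ] (𝟙 (S v) * 𝟙 (S w))
      ≡⟨ sum-cong-≗ (λ v → *-distribˡ-sum (𝟙 (S v)) (𝟙 ∘ S)) ⟨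
    ∑[ v < n ] (𝟙 (S v) * s)
      ≡⟨ *-distribʳ-sum s (𝟙 ∘ S) ⟨
    s * s ∎
    where
    open ≡-Reasoning
    s P : ℕ
    s = count S
    P = arcsInside A S

    arcTo onDiagonal : Fin n → Fin n → ℕ
    arcTo v w      = 𝟙 (S v ∧ (S w ∧ A w v))
    onDiagonal v w = 𝟙 (S v) * 𝟙 (does (v ≟ w))

    pair : ∀ v w → arcTo v w + arcTo w v + onDiagonal v w ≡ 𝟙 (S v) * 𝟙 (S w)
    pair v w with v ≟ w
    pair v .v | yes refl rewrite proj₁ tournament v with S v
    ... | true  = refl
    ... | false = refl
    pair v w  | no v≢w with S v | S w
    ... | true  | true  = trans (+-identityʳ _) (arc-count (v≢w ∘ sym))
    ... | true  | false = refl
    ... | false | true  = refl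
    ... | false | false = refl

    diagonal : ∑[ v < n ] ∑[ w < n ] onDiagonal v w ≡ s
    diagonal = sum-cong-≗ λ v → begin
      ∑[ w < n ] onDiagonal v w            ≡⟨ *-distribˡ-sum (𝟙 (S v)) (λ w → 𝟙 (does (v ≟ w))) ⟨
      𝟙 (S v) * count (λ w → does (v ≟ w)) ≡⟨ cong (𝟙 (S v) *_) (count-≟ v) ⟩
      𝟙 (S v) * 1                          ≡⟨ *-identityʳ _ ⟩
      𝟙 (S v)                              ∎

  bounded-indegree⇒count≤ : ∀ (S : Fin n → Bool) t →
    (∀ v → S v ≡ true → count (λ w → S w ∧ A w v) ≤ t) → count S ≤ suc (t + t)
  bounded-indegree⇒count≤ S t indegree≤t = m*m≤m*n⇒m≤n s (suc (t + t)) (begin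
    s * s             ≡⟨ arcsInside-doubled S ⟨
    P + P + s         ≤⟨ +-monoˡ-≤ s (+-mono-≤ P≤s*t P≤s*t) ⟩
    s * t + s * t + s ≡⟨ reassociate s t ⟩
    s * suc (t + t)   ∎)
    where
    open ≤-Reasoning
    s P : ℕ
    s = count S
    P = arcsInside A S

    P≤s*t : P ≤ s * t
    P≤s*t = arcsInside≤ A S t indegree≤t

    reassociate : ∀ a b → a * b + a * b + a ≡ a * (1 + (b + b))
    reassociate = solve-∀

midpoint : ∀ {n} → Digraph n → Fin n → Fin n → Fin n → Bool
midpoint A u v w = A u w ∧ A w v

#midpoints : ∀ {n} → Digraph n → Fin n → Fin n → ℕ
#midpoints A u v = count (midpoint A u v)

linkage : ∀ {n} → Digraph n → Fin n → Fin n → ℕ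
linkage A u v = #midpoints A u v + #midpoints A v u

linked : ∀ {n} → Digraph n → ℕ → Fin n → Fin n → Bool
linked A t u v = does (linkage A u v ≤? t)

linked⇒linkage≤ : ∀ {n} (A : Digraph n) {t u v} → linked A t u v ≡ true → linkage A u v ≤ t
linked⇒linkage≤ A {t} {u} {v} = does-true⇒ (linkage A u v ≤? t)

close : ∀ {n} → Digraph n → ℕ → Fin n → Fin n → Bool
close A t u v = does (u ≟ v) ∨ linked A t u v

close-refl : ∀ {n} (A : Digraph n) t u → close A t u u ≡ true
close-refl A t u rewrite dec-true (u ≟ u) refl = refl

close-sym : ∀ {n} (A : Digraph n) t u v → close A t u v ≡ close A t v u
close-sym A t u v = cong₂ _∨_ (does-⇔ (mk⇔ sym sym) (u ≟ v) (v ≟ u))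
                              (cong (λ x → does (x ≤? t)) (+-comm (#midpoints A u v) _))

module _ {n : ℕ} {A : Digraph n} (tournament : IsTournament A) where

  #midpoints-asym : ∀ u v → #midpoints A v u ≤ #midpoints A u v + suc (Δ⁺ A ∸ δ⁺ A)
  #midpoints-asym u v = +-cancelʳ-≤ common _ _ (begin
    #midpoints A v u + common         ≤⟨ midpoints+common≤outdeg ⟩
    count (A v)                       ≡⟨ outdeg≡count A v ⟨
    outdeg A v                        ≤⟨ outdeg≤outdeg+Δ⁺∸δ⁺ A u v ⟩
    outdeg A u + d                    ≡⟨ cong (_+ d) (outdeg≡count A u) ⟩
    count (A u) + d                   ≤⟨ +-monoˡ-≤ d outdeg≤midpoints+common ⟩
    #midpoints A u v + suc common + d ≡⟨ shuffle (#midpoints A u v) common d ⟩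
    #midpoints A u v + suc d + common ∎)
    where
    open ≤-Reasoning
    d : ℕ
    d = Δ⁺ A ∸ δ⁺ A

    commonOut : Fin n → Bool
    commonOut w = A u w ∧ A v w

    common : ℕ
    common = count commonOut

    shuffle : ∀ a b c → a + (1 + b) + c ≡ a + (1 + c) + b
    shuffle = solve-∀

    midpoints+common≤outdeg : #midpoints A v u + common ≤ count (A v)
    midpoints+common≤outdeg =
      count-disjoint-⊆ disjoint (λ w → ∧-conicalˡ _ _) (λ w → ∧-conicalʳ _ _)
      where
      disjoint : ∀ w → midpoint A v u w ≡ true → commonOut w ≡ false
      disjoint w vwu rewrite arc-asym tournament (∧-conicalʳ _ _ vwu) = refl

    outdeg≤midpoints+common : count (A u) ≤ #midpoints A u v + suc common
    outdeg≤midpoints+common = begin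
      count (A u)
        ≤⟨ count-⊆ cover ⟩
      count (λ w → midpoint A u v w ∨ (does (v ≟ w) ∨ commonOut w))
        ≤⟨ count-∨ (midpoint A u v) _ ⟩
      #midpoints A u v + count (λ w → does (v ≟ w) ∨ commonOut w)
        ≤⟨ +-monoʳ-≤ _ (count-∨ _ commonOut) ⟩
      #midpoints A u v + (count (λ w → does (v ≟ w)) + common)
        ≡⟨ cong (λ x → #midpoints A u v + (x + common)) (count-≟ v) ⟩
      #midpoints A u v + suc common ∎
      where
      cover : ∀ w → A u w ≡ true → midpoint A u v w ∨ (does (v ≟ w) ∨ commonOut w) ≡ true
      cover w uw with v ≟ w
      ... | yes _ = ∨-zeroʳ (midpoint A u v w)
      ... | no v≢w rewrite uw with A w v in wv
      ...   | true  = refl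
      ...   | false rewrite arc-total tournament (v≢w ∘ sym) wv = refl

  many-midpoints : ∀ c {u v} → (Δ⁺ A ∸ δ⁺ A) + (c + c) < linkage A u v → c ≤ #midpoints A u v
  many-midpoints c {u} {v} far = m+m≤n+n⇒m≤n c m (+-cancelˡ-≤ (suc d) _ _ (begin
    suc d + (c + c)  ≤⟨ far ⟩
    m + #midpoints A v u ≤⟨ +-monoʳ-≤ m (#midpoints-asym u v) ⟩
    m + (m + suc d)  ≡⟨ shuffle m d ⟩
    suc d + (m + m)  ∎))
    where
    open ≤-Reasoning
    d : ℕ
    d = Δ⁺ A ∸ δ⁺ A
    m : ℕ
    m = #midpoints A u v
    shuffle : ∀ a b → a + (a + (1 + b)) ≡ (1 + b) + (a + a)
    shuffle = solve-∀

  ¬close⇒many-midpoints : ∀ c {u v} → close A ((Δ⁺ A ∸ δ⁺ A) + (c + c)) u v ≡ false →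
    c ≤ #midpoints A u v
  ¬close⇒many-midpoints c {u} {v} far =
    many-midpoints c (≰⇒> (does-false⇒¬ (linkage A u v ≤? _) (∨-conicalʳ _ _ far)))

  count-linkedOut≤ : ∀ t u → count (λ w → A u w ∧ linked A t u w) ≤ suc (t + t)
  count-linkedOut≤ t u = bounded-indegree⇒count≤ tournament S t λ v v∈S → begin
    count (λ w → S w ∧ A w v) ≤⟨ count-⊆ (S∧→v⊆midpoint v) ⟩
    #midpoints A u v          ≤⟨ m≤m+n _ _ ⟩
    linkage A u v             ≤⟨ linked⇒linkage≤ A (∧-conicalʳ (A u v) _ v∈S) ⟩
    t                         ∎
    where
    open ≤-Reasoning
    S : Fin n → Bool
    S w = A u w ∧ linked A t u w

    S∧→v⊆midpoint : ∀ v w → S w ∧ A w v ≡ true → midpoint A u v w ≡ true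
    S∧→v⊆midpoint v w e = ∧-intro
      (∧-conicalˡ (A u w) (linked A t u w) (∧-conicalˡ (S w) (A w v) e))
      (∧-conicalʳ (S w) (A w v) e)

  count-linkedIn≤ : ∀ t u → count (λ w → A w u ∧ linked A t u w) ≤ suc (t + t)
  count-linkedIn≤ t u =
    bounded-indegree⇒count≤ (transpose-IsTournament tournament) S t λ v v∈S → begin
      count (λ w → S w ∧ A v w) ≤⟨ count-⊆ (S∧v→⊆midpoint v) ⟩
      #midpoints A v u          ≤⟨ m≤n+m _ _ ⟩
      linkage A u v             ≤⟨ linked⇒linkage≤ A (∧-conicalʳ (A v u) _ v∈S) ⟩
      t                         ∎
    where
    open ≤-Reasoning
    S : Fin n → Bool
    S w = A w u ∧ linked A t u w

    S∧v→⊆midpoint : ∀ v w → S w ∧ A v w ≡ true → midpoint A v u w ≡ true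
    S∧v→⊆midpoint v w e = ∧-intro
      (∧-conicalʳ (S w) (A v w) e)
      (∧-conicalˡ (A w u) (linked A t u w) (∧-conicalˡ (S w) (A v w) e))

  count-close≤ : ∀ t u → count (close A t u) ≤ 4 * t + 3
  count-close≤ t u = begin
    count (close A t u)
      ≤⟨ count-⊆ cover ⟩
    count (λ w → does (u ≟ w) ∨ (linkedOut w ∨ linkedIn w))
      ≤⟨ count-∨ (λ w → does (u ≟ w)) (λ w → linkedOut w ∨ linkedIn w) ⟩
    count (λ w → does (u ≟ w)) + count (λ w → linkedOut w ∨ linkedIn w)
      ≤⟨ +-mono-≤ (≤-reflexive (count-≟ u)) (count-∨ linkedOut linkedIn) ⟩
    1 + (count linkedOut + count linkedIn)
      ≤⟨ +-monoʳ-≤ 1 (+-mono-≤ (count-linkedOut≤ t u) (count-linkedIn≤ t u)) ⟩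
    1 + (suc (t + t) + suc (t + t))
      ≡⟨ simplify t ⟩
    4 * t + 3 ∎
    where
    open ≤-Reasoning
    linkedOut linkedIn : Fin n → Bool
    linkedOut w = A u w ∧ linked A t u w
    linkedIn  w = A w u ∧ linked A t u w

    simplify : ∀ a → 1 + ((1 + (a + a)) + (1 + (a + a))) ≡ 4 * a + 3
    simplify = solve-∀

    cover : ∀ w → close A t u w ≡ true → does (u ≟ w) ∨ (linkedOut w ∨ linkedIn w) ≡ true
    cover w w-close with u ≟ w
    ... | yes _   = refl
    ... | no  u≢w with A u w in uw
    ...   | true  = cong (_∨ linkedIn w) w-close
    ...   | false rewrite arc-total tournament u≢w uw = w-close

Apart : ∀ {n k} → (Fin n → Fin n → Bool) → (Fin k → Fin n) → Set
Apart near f = ∀ i j → i ≢ j → near (f i) (f j) ≡ false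

Apart⇒injective : ∀ {n k} (near : Fin n → Fin n → Bool) → (∀ u → near u u ≡ true) →
  {f : Fin k → Fin n} → Apart near f → ∀ i j → f i ≡ f j → i ≡ j
Apart⇒injective near near-refl {f} f-apart i j fi≡fj with i ≟ j
... | yes i≡j = i≡j
... | no  i≢j = contradiction (trans (sym (f-apart i j i≢j)) fi-near-fj) λ ()
  where
  fi-near-fj : near (f i) (f j) ≡ true
  fi-near-fj = subst (λ x → near (f i) x ≡ true) fi≡fj (near-refl (f i))

module _ {n M : ℕ} (near : Fin n → Fin n → Bool) (near-sym : ∀ u v → near u v ≡ near v u)
         (count-near≤M : ∀ u → count (near u) ≤ M) where

  apart-family-avoiding : ∀ m (X : Fin n → Bool) → count X + m * M < n →
    Σ[ f ∈ (Fin (suc m) → Fin n) ] (∀ i → X (f i) ≡ false) × Apart near f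
  apart-family-avoiding m X room with fresh X (≤-<-trans (m≤m+n (count X) (m * M)) room)
  apart-family-avoiding zero    X room | w , w∉X =
    (λ _ → w) , (λ _ → w∉X) , λ { zero zero 0≢0 → contradiction refl 0≢0 }
  apart-family-avoiding (suc m) X room | w , w∉X
    with apart-family-avoiding m (λ v → X v ∨ near w v) room′
    where
    room′ : count (λ v → X v ∨ near w v) + m * M < n
    room′ = begin-strict
      count (λ v → X v ∨ near w v) + m * M ≤⟨ +-monoˡ-≤ (m * M) (count-∨ X (near w)) ⟩
      count X + count (near w) + m * M     ≤⟨ +-monoˡ-≤ (m * M) (+-monoʳ-≤ (count X) (count-near≤M w)) ⟩
      count X + M + m * M                  ≡⟨ +-assoc (count X) M (m * M) ⟩
      count X + suc m * M                  <⟨ room ⟩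
      n                                    ∎
      where open ≤-Reasoning
  ... | f , f-avoids , f-apart = f′ , f′-avoids , f′-apart
    where
    f′ : Fin (suc (suc m)) → Fin n
    f′ zero    = w
    f′ (suc i) = f i

    f′-avoids : ∀ i → X (f′ i) ≡ false
    f′-avoids zero    = w∉X
    f′-avoids (suc i) = ∨-conicalˡ _ _ (f-avoids i)

    f′-apart : Apart near f′
    f′-apart zero    zero    0≢0 = contradiction refl 0≢0
    f′-apart zero    (suc j) _   = ∨-conicalʳ _ _ (f-avoids j)
    f′-apart (suc i) zero    _   = trans (near-sym (f i) w) (∨-conicalʳ _ _ (f-avoids i))
    f′-apart (suc i) (suc j) i≢j = f-apart i j (i≢j ∘ cong suc)

  apart-family : ∀ m → m * M < n → Σ[ f ∈ (Fin (suc m) → Fin n) ] Apart near f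
  apart-family m room
    with apart-family-avoiding m (λ _ → false) (subst (λ x → x + m * M < n) (sym (count-const-false {n})) room)
  ... | f , _ , f-apart = f , f-apart

subdivision-from-branches : ∀ {n k} (A : Digraph n) (f : Fin k → Fin n) →
  (∀ i j → f i ≡ f j → i ≡ j) → k * k + k ≤ n →
  (∀ i j → i ≢ j → k * k + k ≤ #midpoints A (f i) (f j)) → ContainsSubdivK A k
subdivision-from-branches {n} {k} A f f-injective room many =
  f , g , f-injective , arcs , g-injective , g∉f
  where
  -- Representatives are chosen for all k² pairs; the diagonal ones are padding, for which
  -- every vertex is a candidate.
  candidate : Fin k → Fin k → Fin n → Bool
  candidate i j w = does (i ≟ j) ∨ midpoint A (f i) (f j) w

  enough : ∀ i j → k * k + count (image f) ≤ count (candidate i j)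
  enough i j = ≤-trans (+-monoʳ-≤ (k * k) (count-image f)) (enough′ (i ≟ j))
    where
    enough′ : Dec (i ≡ j) → k * k + k ≤ count (candidate i j)
    enough′ (yes i≡j) = begin
      k * k + k              ≤⟨ room ⟩
      n                      ≡⟨ count-const-true {n} ⟨
      count {n} (λ _ → true) ≤⟨ count-⊆ (λ w _ → cong (_∨ midpoint A (f i) (f j) w) (dec-true (i ≟ j) i≡j)) ⟩
      count (candidate i j)  ∎
      where open ≤-Reasoning
    enough′ (no i≢j) = ≤-trans (many i j i≢j) (count-⊆ {p = midpoint A (f i) (f j)} mid⊆candidate)
      where
      mid⊆candidate : ∀ w → midpoint A (f i) (f j) w ≡ true → candidate i j w ≡ true
      mid⊆candidate w mid = trans (cong (does (i ≟ j) ∨_) mid) (∨-zeroʳ _)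

  representatives : Σ[ h ∈ (Fin (k * k) → Fin n) ]
    (∀ p → uncurry candidate (remQuot k p) (h p) ≡ true × image f (h p) ≡ false) ×
    (∀ p q → h p ≡ h q → p ≡ q)
  representatives =
    distinct-representatives (uncurry candidate ∘ remQuot k) (image f) (uncurry enough ∘ remQuot k)

  h : Fin (k * k) → Fin n
  h = proj₁ representatives

  g : Fin k → Fin k → Fin n
  g i j = h (combine i j)

  chosen : ∀ i j → candidate i j (g i j) ≡ true × image f (g i j) ≡ false
  chosen i j = subst (λ (i′ , j′) → candidate i′ j′ (g i j) ≡ true × image f (g i j) ≡ false)
                     (remQuot-combine i j) (proj₁ (proj₂ representatives) (combine i j))

  arcs : ∀ i j → i ≢ j → A (f i) (g i j) ≡ true × A (g i j) (f j) ≡ true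
  arcs i j i≢j = ∧-conicalˡ _ _ g∈mid , ∧-conicalʳ _ _ g∈mid
    where
    g∈mid : midpoint A (f i) (f j) (g i j) ≡ true
    g∈mid = subst (λ b → b ∨ midpoint A (f i) (f j) (g i j) ≡ true) (dec-false (i ≟ j) i≢j)
                  (proj₁ (chosen i j))

  g-injective : ∀ i j i′ j′ → i ≢ j → i′ ≢ j′ → g i j ≡ g i′ j′ → i ≡ i′ × j ≡ j′
  g-injective i j i′ j′ _ _ e =
    combine-injective i j i′ j′ (proj₂ (proj₂ representatives) (combine i j) (combine i′ j′) e)

  g∉f : ∀ i j l → i ≢ j → g i j ≢ f l
  g∉f i j l _ e = ∉image f (proj₂ (chosen i j)) l (sym e)

budget : ∀ m d n → 10 * suc m * d + 10 * suc m * (suc m ^ 2) ≤ n →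
  let c = suc m * suc m + suc m in m * (4 * (d + (c + c)) + 3) < n × c ≤ n
budget m d n H = ≤-trans (m<m+n _ (s≤s z≤n)) (≤-trans (≤-reflexive (identity₁ m d)) H)
               , ≤-trans (m≤m+n _ _) (≤-trans (≤-reflexive (identity₂ m)) (≤-trans (m≤n+m _ _) H))
  where
  identity₁ : ∀ m d →
    let K = 1 + m; c = K * K + K in
    m * (4 * (d + (c + c)) + 3) + (1 + ((6 * m + 10) * d + 2 * (K * K * K) + 5 * K + 2))
      ≡ 10 * K * d + 10 * K * (K * (K * 1))
  identity₁ = solve-∀
  identity₂ : ∀ m →
    let K = 1 + m in
    (K * K + K) + (10 * (m * m * m) + 29 * (m * m) + 27 * m + 8) ≡ 10 * K * (K * (K * 1))
  identity₂ = solve-∀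

theorem1p2 : (k n : ℕ) → 1 ≤ k → (A : Digraph n) → IsTournament A →
    10 * k * (Δ⁺ A ∸ δ⁺ A) + 10 * k * (k ^ 2) ≤ n →
    ContainsSubdivK A k
theorem1p2 (suc m) n (s≤s z≤n) A tournament H =
  subdivision-from-branches A f f-injective c≤n
    λ i j i≢j → ¬close⇒many-midpoints tournament c (f-apart i j i≢j)
  where
  c t : ℕ
  c = suc m * suc m + suc m
  t = (Δ⁺ A ∸ δ⁺ A) + (c + c)

  room : m * (4 * t + 3) < n
  room = proj₁ (budget m (Δ⁺ A ∸ δ⁺ A) n H)

  c≤n : c ≤ n
  c≤n = proj₂ (budget m (Δ⁺ A ∸ δ⁺ A) n H)

  branches : Σ[ f ∈ (Fin (suc m) → Fin n) ] Apart (close A t) f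
  branches = apart-family (close A t) (close-sym A t) (count-close≤ tournament t) m room

  f : Fin (suc m) → Fin n
  f = proj₁ branches

  f-apart : Apart (close A t) f
  f-apart = proj₂ branches

  f-injective : ∀ i j → f i ≡ f j → i ≡ j
  f-injective = Apart⇒injective (close A t) (close-refl A t) f-apart
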